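{- For integers $t,n$ with $n<-|t-3|$, we have $M_{t,n}=0$.
   Context: Let $\mathbb{N}$ denote the positive integers. Let $M'_{t,n}$ be the cardinality of the union of the sets $A=\{(u,v,w,k)\in\mathbb{N}^3\times\{0,1\}: u\neq w,\ v\ge2,\ n=u+w-v-1+6k,\ (-1)^kt=2+(u+w)(1+v)+uvw\}$ and $B=\{(u,v,w,k)\in\mathbb{N}^3\times\{1,2\}: u,v,w \text{ distinct},\ n=u+v+w-3+6k,\ (-1)^kt=1+u+v+w+u(1+v)+v(1+w)+w(1+u)+(1+u)(1+v)(1+w)\}$. Define $M_{t,n}=M'_{t,n}+1$ if $t\notin\{1,3\}$ and $n\in\{t-3,\,-(t-3)\}$; also $M_{t,n}=M'_{t,n}+1$ if ($t=1$ and $n=\pm2$) or ($t=3$ and $n=0$); and $M_{t,n}=M'_{t,n}$ otherwise. -}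

module Defs where

open import Data.Bool using (Bool; true; false; _∧_; _∨_; not; T; if_then_else_)
open import Data.Nat as ℕ using (ℕ; zero; suc)
open import Data.Integer as ℤ using (ℤ; +_; -_; _+_; _-_; _*_)
open import Data.Product using (Σ; _×_; _,_)
open import Data.Fin using (Fin)
open import Function.Bundles using (_↔_)
open import Relation.Nullary.Decidable using (⌊_⌋)
open import Relation.Binary.PropositionalEquality using (_≡_)

negOnePow : ℕ → ℤ
negOnePow zero    = + 1
negOnePow (suc k) = - negOnePow k

-- Elements (u , v , w , k); positivity of u,v,w and the range of k
-- are imposed in the membership predicates below.
Tuple : Set
Tuple = ℕ × ℕ × ℕ × ℕ

infix 4 _=ℕ_ _≤ℕ_ _=ℤ_
_=ℕ_ : ℕ → ℕ → Bool
a =ℕ b = ⌊ a ℕ.≟ b ⌋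

_≤ℕ_ : ℕ → ℕ → Bool
a ≤ℕ b = ⌊ a ℕ.≤? b ⌋

_=ℤ_ : ℤ → ℤ → Bool
a =ℤ b = ⌊ a ℤ.≟ b ⌋

inA : ℤ → ℤ → Tuple → Bool
inA t n (u , v , w , k) =
  (1 ≤ℕ u) ∧ (1 ≤ℕ v) ∧ (1 ≤ℕ w) ∧ (k ≤ℕ 1)
  ∧ not (u =ℕ w) ∧ (2 ≤ℕ v)
  ∧ (n =ℤ (U + W - V - + 1 + + 6 * K))
  ∧ ((negOnePow k * t) =ℤ (+ 2 + (U + W) * (+ 1 + V) + U * V * W))
  where
    U = + u
    V = + v
    W = + w
    K = + k

inB : ℤ → ℤ → Tuple → Bool
inB t n (u , v , w , k) =
  (1 ≤ℕ u) ∧ (1 ≤ℕ v) ∧ (1 ≤ℕ w) ∧ (1 ≤ℕ k) ∧ (k ≤ℕ 2)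
  ∧ not (u =ℕ v) ∧ not (v =ℕ w) ∧ not (u =ℕ w)
  ∧ (n =ℤ (U + V + W - + 3 + + 6 * K))
  ∧ ((negOnePow k * t) =ℤ
       (+ 1 + U + V + W + U * (+ 1 + V) + V * (+ 1 + W) + W * (+ 1 + U)
         + (+ 1 + U) * (+ 1 + V) * (+ 1 + W)))
  where
    U = + u
    V = + v
    W = + w
    K = + k

inUnion : ℤ → ℤ → Tuple → Bool
inUnion t n x = inA t n x ∨ inB t n x

UnionAB : ℤ → ℤ → Set
UnionAB t n = Σ Tuple (λ x → T (inUnion t n x))

HasCard : Set → ℕ → Set
HasCard X m = X ↔ Fin m

correction : ℤ → ℤ → ℕ
correction t n =
  if (not (t =ℤ + 1) ∧ not (t =ℤ + 3) ∧ ((n =ℤ (t - + 3)) ∨ (n =ℤ (- (t - + 3)))))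
     ∨ ((t =ℤ + 1) ∧ ((n =ℤ + 2) ∨ (n =ℤ - + 2)))
     ∨ ((t =ℤ + 3) ∧ (n =ℤ + 0))
  then 1 else 0

-- "M_{t,n} = m": A ∪ B has cardinality M'_{t,n} and m = M'_{t,n} + correction
MIs : ℤ → ℤ → ℕ → Set
MIs t n m = Σ ℕ (λ m' → HasCard (UnionAB t n) m' × m ≡ m' ℕ.+ correction t n)

{-# OPTIONS --safe #-}
-- Write s = (-1)^k and P for the polynomial with s·t = P. Every element of A ∪ B has
-- n ≥ 3 - P: for A because n + P - 3 = (u + w - 1)(v + 2) + 6k + uvw with u ≥ 1, for B
-- because k ≥ 1 forces n ≥ 3 while P ≥ 0. On the other hand -|t - 3| ≤ 3 - s·t for either
-- sign. Hence n < -|t - 3| leaves A ∪ B empty, and the same hypothesis gives n ≠ ±(t - 3),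
-- which switches the correction term off.
module Submission where

open import Defs
open import Data.Integer using (ℤ; +_; -_; _-_; _<_; ∣_∣)
open import Data.Integer as ℤ using (_+_; _*_; _≤_; 0ℤ; -1ℤ; +≤+; -≤+; +[1+_]; -[1+_]; +0)
open import Data.Integer.Properties as ℤ using (≤-refl; ≤-trans; i≤i+j)
open import Data.Integer.Tactic.RingSolver using (solve-∀)
open import Data.Nat as ℕ using (zero; suc; z≤n)
open import Data.Bool using (T; _∧_; not; false)
open import Data.Bool.Properties using (T-∧; T-∨)
open import Data.Empty using (⊥-elim)
open import Data.Fin using (Fin)
open import Data.Product using (_,_; proj₂)
open import Data.Sum using (_⊎_; inj₁; inj₂; [_,_])
open import Function using (_∘_)
open import Function.Bundles using (_↔_; mk↔ₛ′; Equivalence)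
open import Relation.Nullary using (¬_; yes; no; contradiction)
open import Relation.Nullary.Decidable using (toWitness)
open import Relation.Binary.PropositionalEquality using (_≡_; _≢_; refl; sym; cong; subst; subst₂)

open Equivalence using (to)

-∣i∣≤i : ∀ i → - (+ ∣ i ∣) ≤ i
-∣i∣≤i +0       = ≤-refl
-∣i∣≤i +[1+ m ] = -≤+
-∣i∣≤i -[1+ m ] = ≤-refl

-∣i∣≤-i : ∀ i → - (+ ∣ i ∣) ≤ - i
-∣i∣≤-i i = subst (λ m → - (+ m) ≤ - i) (ℤ.∣-i∣≡∣i∣ i) (-∣i∣≤i (- i))

negOnePow≡±1 : ∀ k → negOnePow k ≡ + 1 ⊎ negOnePow k ≡ -1ℤ
negOnePow≡±1 zero    = inj₁ refl
negOnePow≡±1 (suc k) with negOnePow≡±1 k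
... | inj₁ s≡1  = inj₂ (cong -_ s≡1)
... | inj₂ s≡-1 = inj₁ (cong -_ s≡-1)

neg-minus : ∀ i j → - (i - j) ≡ j - i
neg-minus = solve-∀

-∣t-c∣≤c-±t : ∀ k c t → 0ℤ ≤ c → - (+ ∣ t - c ∣) ≤ c - negOnePow k * t
-∣t-c∣≤c-±t k c t 0≤c with negOnePow≡±1 k
... | inj₁ s≡1 rewrite s≡1 | ℤ.*-identityˡ t = begin
  - (+ ∣ t - c ∣) ≤⟨ -∣i∣≤-i (t - c) ⟩
  - (t - c)       ≡⟨ neg-minus t c ⟩
  c - t           ∎
  where open ℤ.≤-Reasoning
... | inj₂ s≡-1 rewrite s≡-1 | ℤ.-1*i≡-i t | ℤ.neg-involutive t = begin
  - (+ ∣ t - c ∣) ≤⟨ -∣i∣≤i (t - c) ⟩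
  t - c           ≤⟨ ℤ.+-monoʳ-≤ t (ℤ.≤-trans (ℤ.neg-mono-≤ 0≤c) 0≤c) ⟩
  t + c           ≡⟨ ℤ.+-comm t c ⟩
  c + t           ∎
  where open ℤ.≤-Reasoning

0≤+ : ∀ n → 0ℤ ≤ + n
0≤+ n = +≤+ z≤n

0≤i+j : ∀ {i j} → 0ℤ ≤ i → 0ℤ ≤ j → 0ℤ ≤ i + j
0≤i+j = ℤ.+-mono-≤

0≤i*j : ∀ {i j} → 0ℤ ≤ i → 0ℤ ≤ j → 0ℤ ≤ i * j
0≤i*j {+ m} {+ n} _ _ = subst (0ℤ ≤_) (ℤ.pos-* m n) (0≤+ (m ℕ.* n))

i≤i+nonNeg : ∀ i {j} → 0ℤ ≤ j → i ≤ i + j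
i≤i+nonNeg i {j} 0≤j = i≤i+j i j {{ℤ.nonNegative 0≤j}}

nA : ℤ → ℤ → ℤ → ℤ → ℤ
nA U V W K = U + W - V - + 1 + + 6 * K

PA : ℤ → ℤ → ℤ → ℤ
PA U V W = + 2 + (U + W) * (+ 1 + V) + U * V * W

nB : ℤ → ℤ → ℤ → ℤ → ℤ
nB U V W K = U + V + W - + 3 + + 6 * K

PB : ℤ → ℤ → ℤ → ℤ
PB U V W = + 1 + U + V + W + U * (+ 1 + V) + V * (+ 1 + W) + W * (+ 1 + U)
         + (+ 1 + U) * (+ 1 + V) * (+ 1 + W)

0≤PB : ∀ u v w → 0ℤ ≤ PB (+ u) (+ v) (+ w)
0≤PB u v w =
  0≤i+j (0≤i+j (0≤i+j (0≤i+j (0≤+ (suc (u ℕ.+ v ℕ.+ w)))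
    (0≤i*j (0≤+ u) (0≤+ (suc v))))
    (0≤i*j (0≤+ v) (0≤+ (suc w))))
    (0≤i*j (0≤+ w) (0≤+ (suc u))))
    (0≤i*j (0≤i*j (0≤+ (suc u)) (0≤+ (suc v))) (0≤+ (suc w)))

nA-slack : ∀ A V W K → let U = + 1 + A in
  U + W - V - + 1 + + 6 * K
    ≡ + 3 - (+ 2 + (U + W) * (+ 1 + V) + U * V * W) + ((A + W) * (+ 2 + V) + + 6 * K + U * V * W)
nA-slack = solve-∀

nB-slack : ∀ U V W J P →
  U + V + W - + 3 + + 6 * (+ 1 + J) ≡ + 3 - P + (U + V + W + + 6 * J + P)
nB-slack = solve-∀

3-PA≤nA : ∀ a v w k → + 3 - PA (+ suc a) (+ v) (+ w) ≤ nA (+ suc a) (+ v) (+ w) (+ k)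
3-PA≤nA a v w k = subst (+ 3 - PA U V W ≤_) (sym (nA-slack (+ a) V W K))
  (i≤i+nonNeg (+ 3 - PA U V W)
    (0≤i+j (0≤i+j (0≤i*j (0≤+ (a ℕ.+ w)) (0≤+ (2 ℕ.+ v))) (0≤i*j (0≤+ 6) (0≤+ k)))
           (0≤i*j (0≤i*j (0≤+ (suc a)) (0≤+ v)) (0≤+ w))))
  where U = + suc a ; V = + v ; W = + w ; K = + k

3-PB≤nB : ∀ u v w j → + 3 - PB (+ u) (+ v) (+ w) ≤ nB (+ u) (+ v) (+ w) (+ suc j)
3-PB≤nB u v w j = subst (+ 3 - P ≤_) (sym (nB-slack U V W (+ j) P))
  (i≤i+nonNeg (+ 3 - P) (0≤i+j (0≤i+j (0≤+ (u ℕ.+ v ℕ.+ w)) (0≤i*j (0≤+ 6) (0≤+ j))) (0≤PB u v w)))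
  where U = + u ; V = + v ; W = + w ; P = PB U V W

T-∧⇒Tʳ : ∀ x {y} → T (x ∧ y) → T y
T-∧⇒Tʳ x = proj₂ ∘ to (T-∧ {x})

=ℤ⇒≡ : ∀ {i j} → T (i =ℤ j) → i ≡ j
=ℤ⇒≡ {i} {j} = toWitness {a? = i ℤ.≟ j}

3-P≤Q⇒3-S≤n : ∀ {n S} P Q → + 3 - P ≤ Q → T ((n =ℤ Q) ∧ (S =ℤ P)) → + 3 - S ≤ n
3-P≤Q⇒3-S≤n P Q 3-P≤Q eqs with n≡Q , S≡P ← to T-∧ eqs =
  subst₂ (λ m P → + 3 - P ≤ m) (sym (=ℤ⇒≡ n≡Q)) (sym (=ℤ⇒≡ S≡P)) 3-P≤Q

-- Tests of the form `1 ≤ℕ suc _` compute to true and vanish from the conjunction.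
inA⇒3-±t≤n : ∀ {t n} u v w k → T (inA t n (u , v , w , k)) → + 3 - negOnePow k * t ≤ n
inA⇒3-±t≤n zero    v w k ()
inA⇒3-±t≤n (suc a) v w k h =
  3-P≤Q⇒3-S≤n (PA (+ suc a) (+ v) (+ w)) (nA (+ suc a) (+ v) (+ w) (+ k)) (3-PA≤nA a v w k)
    (T-∧⇒Tʳ (2 ≤ℕ v) (T-∧⇒Tʳ (not (suc a =ℕ w)) (T-∧⇒Tʳ (k ≤ℕ 1)
    (T-∧⇒Tʳ (1 ≤ℕ w) (T-∧⇒Tʳ (1 ≤ℕ v) h)))))

inB⇒3-±t≤n : ∀ {t n} u v w k → T (inB t n (u , v , w , k)) → + 3 - negOnePow k * t ≤ n
inB⇒3-±t≤n u v w zero h =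
  ⊥-elim (T-∧⇒Tʳ (1 ≤ℕ w) {false} (T-∧⇒Tʳ (1 ≤ℕ v) (T-∧⇒Tʳ (1 ≤ℕ u) h)))
inB⇒3-±t≤n u v w (suc j) h =
  3-P≤Q⇒3-S≤n (PB (+ u) (+ v) (+ w)) (nB (+ u) (+ v) (+ w) (+ suc j)) (3-PB≤nB u v w j)
    (T-∧⇒Tʳ (not (u =ℕ w)) (T-∧⇒Tʳ (not (v =ℕ w)) (T-∧⇒Tʳ (not (u =ℕ v))
    (T-∧⇒Tʳ (suc j ≤ℕ 2) (T-∧⇒Tʳ (1 ≤ℕ w) (T-∧⇒Tʳ (1 ≤ℕ v) (T-∧⇒Tʳ (1 ≤ℕ u) h)))))))

-∣t-3∣≤n : ∀ {t n} x → T (inUnion t n x) → - (+ ∣ t - + 3 ∣) ≤ n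
-∣t-3∣≤n {t} {n} x@(u , v , w , k) h = ≤-trans (-∣t-c∣≤c-±t k (+ 3) t (0≤+ 3))
  ([ inA⇒3-±t≤n u v w k , inB⇒3-±t≤n u v w k ] (to (T-∨ {inA t n x}) h))

≢⇒=ℤ≡false : ∀ {i j} → i ≢ j → (i =ℤ j) ≡ false
≢⇒=ℤ≡false {i} {j} i≢j with i ℤ.≟ j
... | yes i≡j = contradiction i≡j i≢j
... | no _    = refl

correction≡0 : ∀ t n → n ≢ t - + 3 → n ≢ - (t - + 3) → correction t n ≡ 0
correction≡0 t n n≢t-3 n≢3-t with t ℤ.≟ + 1 | t ℤ.≟ + 3
... | yes refl | no _
  rewrite ≢⇒=ℤ≡false n≢3-t | ≢⇒=ℤ≡false n≢t-3 = refl
... | no _ | yes refl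
  rewrite ≢⇒=ℤ≡false n≢t-3 = refl
... | no _ | no _
  rewrite ≢⇒=ℤ≡false n≢t-3 | ≢⇒=ℤ≡false n≢3-t = refl

¬A⇒A↔Fin0 : ∀ {A : Set} → ¬ A → A ↔ Fin 0
¬A⇒A↔Fin0 ¬a = mk↔ₛ′ (⊥-elim ∘ ¬a) (λ ()) (λ ()) (⊥-elim ∘ ¬a)

proposition4p6 : (t n : ℤ) → n < - (+ ∣ t - + 3 ∣) → MIs t n 0
proposition4p6 t n n<-∣t-3∣ =
  0 , ¬A⇒A↔Fin0 (λ (x , h) → ℤ.<⇒≱ n<-∣t-3∣ (-∣t-3∣≤n x h))
    , sym (correction≡0 t n n≢t-3 n≢3-t)
  where
  n≢t-3 : n ≢ t - + 3
  n≢t-3 = ℤ.<⇒≢ (ℤ.<-≤-trans n<-∣t-3∣ (-∣i∣≤i (t - + 3)))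
  n≢3-t : n ≢ - (t - + 3)
  n≢3-t = ℤ.<⇒≢ (ℤ.<-≤-trans n<-∣t-3∣ (-∣i∣≤-i (t - + 3)))
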